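{- Let $G$ be a finite simple graph and $R$ a graph orientation of $G$. There is at most one configuration on $G$ which both induces $R$ and is a $0$-preposition.
   Context: A configuration on $G$ assigns an integer stack size $|v|$ to each vertex. Firing a configuration $C$ changes each $v$ simultaneously from $|v|^C$ to $|v|^C + |\{u\in N(v): |u|^C>|v|^C\}| - |\{u\in N(v): |u|^C<|v|^C\}|$. A graph orientation of $G$ assigns to each edge $xy$ either a direction ($x\to y$ or $y\to x$) or leaves it flat (undirected). A configuration $C$ induces the orientation in which each edge $uv$ is directed $u\to v$ if $|u|^C>|v|^C$, $v\to u$ if $|v|^C>|u|^C$, and flat if $|u|^C=|v|^C$. A configuration $C$ is a $0$-preposition if firing $C$ yields the configuration in which every vertex has $0$ chips. -}

module Defs where

open import Data.Nat using (ℕ)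
open import Data.Integer using (ℤ; _+_; -_; 0ℤ; 1ℤ; _<?_)
open import Data.Fin using (Fin)
open import Data.Bool using (Bool; true; false)
open import Data.Vec.Functional using () renaming (foldr to vfoldr)
open import Relation.Nullary using (¬_; yes; no)
open import Relation.Binary.PropositionalEquality using (_≡_)

record SimpleGraph (n : ℕ) : Set where
  field
    adj       : Fin n → Fin n → Bool
    symmetric : ∀ u v → adj u v ≡ adj v u
    irreflexive : ∀ v → adj v v ≡ false
open SimpleGraph public

Config : ℕ → Set
Config n = Fin n → ℤ

Σᶠ : ∀ {n} → (Fin n → ℤ) → ℤ
Σᶠ f = vfoldr _+_ 0ℤ f

contrib : ℤ → ℤ → ℤ
contrib cu cv with cv <? cu
... | yes _ = 1ℤ
... | no _ with cu <? cv
...   | yes _ = - 1ℤ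
...   | no _ = 0ℤ

edgeContrib : Bool → ℤ → ℤ → ℤ
edgeContrib true  cu cv = contrib cu cv
edgeContrib false _  _  = 0ℤ

fire : ∀ {n} → SimpleGraph n → Config n → Config n
fire G C v = C v + Σᶠ (λ u → edgeContrib (adj G u v) (C u) (C v))

zeroConfig : ∀ {n} → Config n
zeroConfig _ = 0ℤ

IsZeroPreposition : ∀ {n} → SimpleGraph n → Config n → Set
IsZeroPreposition G C = ∀ v → fire G C v ≡ zeroConfig v

-- Status of an ordered pair (x , y) of an edge:
-- fwd means x → y, bwd means y → x, flat means undirected.
data EdgeDir : Set where
  fwd bwd flat : EdgeDir

flipDir : EdgeDir → EdgeDir
flipDir fwd = bwd
flipDir bwd = fwd
flipDir flat = flat

record Orientation {n : ℕ} (G : SimpleGraph n) : Set where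
  field
    dir        : Fin n → Fin n → EdgeDir
    consistent : ∀ x y → adj G x y ≡ true → dir y x ≡ flipDir (dir x y)
open Orientation public

inducedDir : ℤ → ℤ → EdgeDir
inducedDir cu cv with cv <? cu
... | yes _ = fwd
... | no _ with cu <? cv
...   | yes _ = bwd
...   | no _ = flat

Induces : ∀ {n} {G : SimpleGraph n} → Config n → Orientation G → Set
Induces {n} {G} C R = ∀ u v → adj G u v ≡ true → dir R u v ≡ inducedDir (C u) (C v)

-- Firing adds to each stack |v| a quantity that depends only on the
-- orientation induced around v.  Two configurations inducing the same
-- orientation therefore change by the same amount at every vertex, and if
-- both fire to zero, their stacks must already agree.
module Submission where

open import Defs
open import Data.Nat using (ℕ; zero; suc)
open import Data.Integer using (ℤ; _+_; -_; 0ℤ; 1ℤ; _<?_)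
open import Data.Integer.Properties using (+-0-abelianGroup)
open import Data.Fin using (Fin)
open import Data.Bool using (true; false)
open import Relation.Nullary using (yes; no)
open import Relation.Binary.PropositionalEquality
  using (_≡_; refl; sym; trans; cong; cong₂)
open import Algebra.Bundles using (AbelianGroup)
open import Algebra.Properties.Group (AbelianGroup.group +-0-abelianGroup)
  using (∙-cancelʳ)

Σᶠ-cong : ∀ {n} {f g : Fin n → ℤ} → (∀ i → f i ≡ g i) → Σᶠ f ≡ Σᶠ g
Σᶠ-cong {zero}  f≗g = refl
Σᶠ-cong {suc n} f≗g = cong₂ _+_ (f≗g Fin.zero) (Σᶠ-cong (λ i → f≗g (Fin.suc i)))

dirSign : EdgeDir → ℤ
dirSign fwd  = 1ℤ
dirSign bwd  = - 1ℤ
dirSign flat = 0ℤ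

contrib≡dirSign∘inducedDir : ∀ cu cv → contrib cu cv ≡ dirSign (inducedDir cu cv)
contrib≡dirSign∘inducedDir cu cv with cv <? cu
... | yes _ = refl
... | no _ with cu <? cv
...   | yes _ = refl
...   | no _  = refl

firingChange : ∀ {n} → SimpleGraph n → Config n → Fin n → ℤ
firingChange G C v = Σᶠ (λ u → edgeContrib (adj G u v) (C u) (C v))

firingChange-induced : ∀ {n} {G : SimpleGraph n} (R : Orientation G) {C D : Config n} →
  Induces C R → Induces D R → ∀ v → firingChange G C v ≡ firingChange G D v
firingChange-induced {G = G} R {C} {D} C↝R D↝R v = Σᶠ-cong (λ u → sameEdgeContrib u (adj G u v) refl)
  where
  sameEdgeContrib : ∀ u b → adj G u v ≡ b →
    edgeContrib b (C u) (C v) ≡ edgeContrib b (D u) (D v)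
  sameEdgeContrib u false _  = refl
  sameEdgeContrib u true  uv = trans (contrib≡dirSign∘inducedDir (C u) (C v))
    (trans (cong dirSign (trans (sym (C↝R u v uv)) (D↝R u v uv)))
           (sym (contrib≡dirSign∘inducedDir (D u) (D v))))

mainTheorem6 : (n : ℕ) (G : SimpleGraph n) (R : Orientation G) (C D : Config n) →
    Induces C R → IsZeroPreposition G C →
    Induces D R → IsZeroPreposition G D →
    ∀ v → C v ≡ D v
mainTheorem6 n G R C D C↝R C↦0 D↝R D↦0 v = ∙-cancelʳ (firingChange G D v) (C v) (D v) firedEqual
  where
  firedEqual : C v + firingChange G D v ≡ D v + firingChange G D v
  firedEqual = trans (cong (C v +_) (sym (firingChange-induced R C↝R D↝R v)))
                     (trans (C↦0 v) (sym (D↦0 v)))
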